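{- $\mathcal{L}_{FH}\preceq\mathcal{L}_{AIL}$: for every $\varphi\in\mathcal{L}_{FH}$ there exists $\psi\in\mathcal{L}_{AIL}$ such that for every epistemic model with awareness $M$ and every world $w$ of $M$, $M,w\vDash_{FH}\varphi$ iff $M,w\vDash_{AIL}\psi$.
   Context: Let $\mathcal{P}$ be a countable set of atomic propositions and $\mathcal{G}$ a finite set of agents. $\mathcal{L}_{AIL}$ is generated by $\varphi::= p\mid\neg\varphi\mid\varphi\wedge\varphi\mid A_i\varphi\mid I_i\varphi\mid E_i\varphi\mid[\approx]_i\varphi\mid[\circ^+]_i\varphi$ ($p\in\mathcal{P}$, $i\in\mathcal{G}$); $\mathcal{L}_{FH}$ is generated by $\varphi::= p\mid\neg\varphi\mid\varphi\wedge\varphi\mid A_i\varphi\mid I_i\varphi\mid E_i\varphi$. $At(\varphi)$ is the set of atoms occurring in $\varphi$. An epistemic model with awareness is $M=\langle W,\{\sim_i,\mathscr{A}_i\}_{i\in\mathcal{G}},V\rangle$ where $W\neq\emptyset$, each $\sim_i$ is an equivalence relation on $W$, each $\mathscr{A}_i:W\to 2^{\mathcal{P}}$ satisfies: if $(w,v)\in\sim_i$ then $\mathscr{A}_i(w)=\mathscr{A}_i(v)$, and $V:\mathcal{P}\to 2^W$. The A-equivalence relation $\approx_i$: $(w,v)\in\approx_i$ iff $\mathscr{A}_i(w)=\mathscr{A}_i(v)$ and for every $p\in\mathscr{A}_i(w)$, $w\in V(p)$ iff $v\in V(p)$. $\sim_i\circ\approx_i=\{(w,u)\mid\exists t\,((w,t)\in\approx_i,(t,u)\in\sim_i)\}$,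 $(\sim_i\circ\approx_i)^+$ its transitive closure. Semantics $\vDash_{AIL}$: $M,w\vDash p$ iff $w\in V(p)$; Booleans as usual; $M,w\vDash A_i\varphi$ iff $At(\varphi)\subseteq\mathscr{A}_i(w)$; $M,w\vDash I_i\varphi$ iff $\varphi$ holds at all $v$ with $(w,v)\in\sim_i$; $M,w\vDash[\approx]_i\varphi$ iff $\varphi$ holds at all $v$ with $(w,v)\in\approx_i$; $M,w\vDash[\circ^+]_i\varphi$ iff $\varphi$ holds at all $v$ with $(w,v)\in(\sim_i\circ\approx_i)^+$; $M,w\vDash E_i\varphi$ iff $M,w\vDash A_i\varphi$ and $M,w\vDash[\circ^+]_i\varphi$. Semantics $\vDash_{FH}$ for $\mathcal{L}_{FH}$ on the same models: same clauses for atoms, Booleans, $A_i$, $I_i$, but $M,w\vDash_{FH}E_i\varphi$ iff $M,w\vDash_{FH}A_i\varphi$ and $M,w\vDash_{FH}I_i\varphi$. -}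

module Defs where

open import Data.Nat using (ℕ)
open import Data.Fin using (Fin)
open import Data.Product using (_×_; Σ; ∃; _,_)
open import Data.Sum using (_⊎_)
open import Data.Empty using (⊥)
open import Relation.Nullary using (¬_)
open import Relation.Binary.PropositionalEquality using (_≡_)
open import Relation.Binary.Structures using (IsEquivalence)
open import Function.Bundles using (_↣_; _⇔_)

-- Atomic propositions: a countable set P (witnessed by an injection into ℕ).
-- Agents: a finite set, represented as Fin n.

module Logic (P : Set) (n : ℕ) where

  Agent : Set
  Agent = Fin n

  data AIL : Set where
    atom : P → AIL
    ¬'_  : AIL → AIL
    _∧'_ : AIL → AIL → AIL
    A    : Agent → AIL → AIL
    I    : Agent → AIL → AIL
    E    : Agent → AIL → AIL
    [≈]  : Agent → AIL → AIL
    [∘⁺] : Agent → AIL → AIL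

  data FH : Set where
    atom : P → FH
    ¬'_  : FH → FH
    _∧'_ : FH → FH → FH
    A    : Agent → FH → FH
    I    : Agent → FH → FH
    E    : Agent → FH → FH

  data _∈AtAIL_ (p : P) : AIL → Set where
    atom : p ∈AtAIL atom p
    neg  : ∀ {φ} → p ∈AtAIL φ → p ∈AtAIL (¬' φ)
    andl : ∀ {φ ψ} → p ∈AtAIL φ → p ∈AtAIL (φ ∧' ψ)
    andr : ∀ {φ ψ} → p ∈AtAIL ψ → p ∈AtAIL (φ ∧' ψ)
    inA  : ∀ {i φ} → p ∈AtAIL φ → p ∈AtAIL (A i φ)
    inI  : ∀ {i φ} → p ∈AtAIL φ → p ∈AtAIL (I i φ)
    inE  : ∀ {i φ} → p ∈AtAIL φ → p ∈AtAIL (E i φ)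
    in≈  : ∀ {i φ} → p ∈AtAIL φ → p ∈AtAIL ([≈] i φ)
    in∘  : ∀ {i φ} → p ∈AtAIL φ → p ∈AtAIL ([∘⁺] i φ)

  data _∈AtFH_ (p : P) : FH → Set where
    atom : p ∈AtFH atom p
    neg  : ∀ {φ} → p ∈AtFH φ → p ∈AtFH (¬' φ)
    andl : ∀ {φ ψ} → p ∈AtFH φ → p ∈AtFH (φ ∧' ψ)
    andr : ∀ {φ ψ} → p ∈AtFH ψ → p ∈AtFH (φ ∧' ψ)
    inA  : ∀ {i φ} → p ∈AtFH φ → p ∈AtFH (A i φ)
    inI  : ∀ {i φ} → p ∈AtFH φ → p ∈AtFH (I i φ)
    inE  : ∀ {i φ} → p ∈AtFH φ → p ∈AtFH (E i φ)

  -- Epistemic model with awareness. Subsets of P / W are predicates.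
  record Model : Set₁ where
    field
      W      : Set
      inhab  : W
      _∼⟨_⟩_ : W → Agent → W → Set
      ∼-equiv : ∀ i → IsEquivalence (λ w v → w ∼⟨ i ⟩ v)
      Aw     : Agent → W → P → Set
      Aw-inv : ∀ i w v → w ∼⟨ i ⟩ v → ∀ p → (Aw i w p ⇔ Aw i v p)
      V      : P → W → Set

    _≈⟨_⟩_ : W → Agent → W → Set
    w ≈⟨ i ⟩ v = (∀ p → (Aw i w p ⇔ Aw i v p))
               × (∀ p → Aw i w p → (V p w ⇔ V p v))

    _∘⟨_⟩_ : W → Agent → W → Set
    w ∘⟨ i ⟩ u = Σ W (λ t → (w ≈⟨ i ⟩ t) × (t ∼⟨ i ⟩ u))

    data _∘⁺⟨_⟩_ : W → Agent → W → Set where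
      [_] : ∀ {w i u} → w ∘⟨ i ⟩ u → w ∘⁺⟨ i ⟩ u
      _∷_ : ∀ {w i t u} → w ∘⟨ i ⟩ t → t ∘⁺⟨ i ⟩ u → w ∘⁺⟨ i ⟩ u

  open Model

  _,_⊨AIL_ : (M : Model) → W M → AIL → Set
  M , w ⊨AIL atom p = V M p w
  M , w ⊨AIL (¬' φ) = ¬ (M , w ⊨AIL φ)
  M , w ⊨AIL (φ ∧' ψ) = (M , w ⊨AIL φ) × (M , w ⊨AIL ψ)
  M , w ⊨AIL A i φ = ∀ p → p ∈AtAIL φ → Aw M i w p
  M , w ⊨AIL I i φ = ∀ v → _∼⟨_⟩_ M w i v → M , v ⊨AIL φ
  M , w ⊨AIL E i φ = (∀ p → p ∈AtAIL φ → Aw M i w p)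
                   × (∀ v → _∘⁺⟨_⟩_ M w i v → M , v ⊨AIL φ)
  M , w ⊨AIL [≈] i φ = ∀ v → _≈⟨_⟩_ M w i v → M , v ⊨AIL φ
  M , w ⊨AIL [∘⁺] i φ = ∀ v → _∘⁺⟨_⟩_ M w i v → M , v ⊨AIL φ

  _,_⊨FH_ : (M : Model) → W M → FH → Set
  M , w ⊨FH atom p = V M p w
  M , w ⊨FH (¬' φ) = ¬ (M , w ⊨FH φ)
  M , w ⊨FH (φ ∧' ψ) = (M , w ⊨FH φ) × (M , w ⊨FH ψ)
  M , w ⊨FH A i φ = ∀ p → p ∈AtFH φ → Aw M i w p
  M , w ⊨FH I i φ = ∀ v → _∼⟨_⟩_ M w i v → M , v ⊨FH φ
  M , w ⊨FH E i φ = (∀ p → p ∈AtFH φ → Aw M i w p)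
                  × (∀ v → _∼⟨_⟩_ M w i v → M , v ⊨FH φ)

{-# OPTIONS --safe #-}
module Submission where

-- In L_FH explicit knowledge E_i φ is simply A_i φ ∧ I_i φ, a formula L_AIL
-- can write itself. Translating E_i φ that way and everything else
-- homomorphically keeps the atoms of every formula, hence every awareness
-- condition, so a routine induction shows the translation preserves truth.

open import Defs
open import Data.Nat using (ℕ)
open import Data.Product using (Σ; _,_)
open import Data.Product.Function.NonDependent.Propositional using (_×-⇔_)
open import Function.Bundles using (_↣_; _⇔_; mk⇔; Equivalence)
open import Function.Construct.Identity using (⇔-id)
open import Function.Related.TypeIsomorphisms using (→-cong-⇔; ¬-cong-⇔)

Π-cong-⇔ : {X : Set} {B C : X → Set} →
           (∀ x → B x ⇔ C x) → (∀ x → B x) ⇔ (∀ x → C x)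
Π-cong-⇔ B⇔C = mk⇔ (λ f x → to (B⇔C x) (f x)) (λ g x → from (B⇔C x) (g x))
  where open Equivalence

□-cong-⇔ : {X : Set} {R B C : X → Set} →
           (∀ x → B x ⇔ C x) → (∀ x → R x → B x) ⇔ (∀ x → R x → C x)
□-cong-⇔ {R = R} B⇔C = Π-cong-⇔ λ x → →-cong-⇔ (⇔-id (R x)) (B⇔C x)

module Translation (P : Set) (n : ℕ) where
  open Logic P n
  open Model

  translate : FH → AIL
  translate (atom p) = atom p
  translate (¬' φ)   = ¬' translate φ
  translate (φ ∧' ψ) = translate φ ∧' translate ψ
  translate (A i φ)  = A i (translate φ)
  translate (I i φ)  = I i (translate φ)
  translate (E i φ)  = A i (translate φ) ∧' I i (translate φ)

  ∈At-translate⁺ : ∀ {p} φ → p ∈AtFH φ → p ∈AtAIL translate φ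
  ∈At-translate⁺ (atom _) atom     = atom
  ∈At-translate⁺ (¬' φ)   (neg x)  = neg (∈At-translate⁺ φ x)
  ∈At-translate⁺ (φ ∧' _) (andl x) = andl (∈At-translate⁺ φ x)
  ∈At-translate⁺ (_ ∧' ψ) (andr x) = andr (∈At-translate⁺ ψ x)
  ∈At-translate⁺ (A i φ)  (inA x)  = inA (∈At-translate⁺ φ x)
  ∈At-translate⁺ (I i φ)  (inI x)  = inI (∈At-translate⁺ φ x)
  ∈At-translate⁺ (E i φ)  (inE x)  = andl (inA (∈At-translate⁺ φ x))

  ∈At-translate⁻ : ∀ {p} φ → p ∈AtAIL translate φ → p ∈AtFH φ
  ∈At-translate⁻ (atom _) atom             = atom
  ∈At-translate⁻ (¬' φ)   (neg x)          = neg (∈At-translate⁻ φ x)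
  ∈At-translate⁻ (φ ∧' _) (andl x)         = andl (∈At-translate⁻ φ x)
  ∈At-translate⁻ (_ ∧' ψ) (andr x)         = andr (∈At-translate⁻ ψ x)
  ∈At-translate⁻ (A i φ)  (inA x)          = inA (∈At-translate⁻ φ x)
  ∈At-translate⁻ (I i φ)  (inI x)          = inI (∈At-translate⁻ φ x)
  ∈At-translate⁻ (E i φ)  (andl (inA x))   = inE (∈At-translate⁻ φ x)
  ∈At-translate⁻ (E i φ)  (andr (inI x))   = inE (∈At-translate⁻ φ x)

  ∈At-translate : ∀ {p} φ → p ∈AtFH φ ⇔ p ∈AtAIL translate φ
  ∈At-translate φ = mk⇔ (∈At-translate⁺ φ) (∈At-translate⁻ φ)

  aware-translate : (S : P → Set) (φ : FH) →
                    (∀ p → p ∈AtFH φ → S p) ⇔ (∀ p → p ∈AtAIL translate φ → S p)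
  aware-translate S φ = Π-cong-⇔ λ p → →-cong-⇔ (∈At-translate φ) (⇔-id (S p))

  translate-sound : ∀ φ (M : Model) (w : W M) →
                    (M , w ⊨FH φ) ⇔ (M , w ⊨AIL translate φ)
  translate-sound (atom p) M w = ⇔-id (V M p w)
  translate-sound (¬' φ)   M w = ¬-cong-⇔ (translate-sound φ M w)
  translate-sound (φ ∧' ψ) M w = translate-sound φ M w ×-⇔ translate-sound ψ M w
  translate-sound (A i φ)  M w = aware-translate (Aw M i w) φ
  translate-sound (I i φ)  M w = □-cong-⇔ λ v → translate-sound φ M v
  translate-sound (E i φ)  M w =
    aware-translate (Aw M i w) φ ×-⇔ (□-cong-⇔ λ v → translate-sound φ M v)

lemma2 : (P : Set) → (P ↣ ℕ) → (n : ℕ) →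
    let open Logic P n in
    (φ : FH) → Σ AIL (λ ψ → (M : Model) → (w : Model.W M) →
    ((M , w ⊨FH φ) ⇔ (M , w ⊨AIL ψ)))
lemma2 P _ n φ = translate φ , translate-sound φ
  where open Translation P n
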